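{- Each of the algorithms \textsf{P}, \textsf{E}, \textsf{A}, \textsf{R}, \textsf{RA} (defined below), run on an undirected graph with vertex set $[n]$, maintains the following invariant at all times: any two roots that lie in the same connected component of the input graph are connected by a path of current edges.
   Context: Each edge $e$ has two ends $e.v,e.w$; the current edge set is initially the input edge set (it is changed only by \textsc{alter}). Each vertex $v$ has a parent $v.p$, initially $v$; $v$ is a root if $v.p=v$. Vertices are compared as integers. Each operation is performed simultaneously for all edges/vertices using values at the start of the operation. \textsc{connect}: for each edge $e$, send $\min\{e.v,e.w\}$ to $\max\{e.v,e.w\}$. \textsc{parent-connect}: for each edge $e$, let $x=e.v.p$, $y=e.w.p$; send $\min\{x,y\}$ to $\max\{x,y\}$. \textsc{extended-connect}: for each edge $e$, let $x=e.v.p$, $y=e.w.p$; if $y<x$ send $y$ to $e.v$ and to $x$, else send $x$ to $e.w$ and to $y$. \textsc{update}: for each vertex $v$, replace $v.p$ by the minimum of $v.p$ and the vertices sent to $v$ in the preceding connect operation. \textsc{root-update}: the same, but only for roots $v$. \textsc{shortcut}: for each vertex $v$, replace $v.p$ by $(v.p).p$. \textsc{alter}: for each edge $e$, let $x=e.v.p$, $y=e.w.p$; if $x=y$ delete $e$, else replace $e.v,e.w$ by $x,y$. Each algorithm repeats a round until a round in which no parent changes: \textsf{P}: \textsc{parent-connect}; \textsc{update}; \textsc{shortcut}. \textsf{E}: \textsc{extended-connect}; \textsc{update}; \textsc{shortcut}. \textsf{A}: \textsc{connect}; \textsc{update}; \textsc{shortcut}; \textsc{alter}. \textsf{R}: \textsc{parent-connect};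 \textsc{root-update}; \textsc{shortcut}. \textsf{RA}: \textsc{connect}; \textsc{root-update}; \textsc{shortcut}; \textsc{alter}. -}

module Defs where

open import Data.Nat using (ℕ; _<ᵇ_)
open import Data.Fin using (Fin; toℕ; _≟_)
open import Data.Bool using (Bool; true; false; if_then_else_)
open import Data.List using (List; []; _∷_; _++_; foldr; concatMap)
open import Data.List.Membership.Propositional using (_∈_)
open import Data.Product using (_×_; _,_; ∃; ∃-syntax)
open import Data.Sum using (_⊎_)
open import Relation.Nullary using (yes; no; ¬_)
open import Relation.Binary.PropositionalEquality using (_≡_)

-- Vertices of [n] are represented by Fin n, compared as integers via toℕ.
-- An edge e has two ends (e.v , e.w).
Edge : ℕ → Set
Edge n = Fin n × Fin n

minV : ∀ {n} → Fin n → Fin n → Fin n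
minV x y = if toℕ y <ᵇ toℕ x then y else x

maxV : ∀ {n} → Fin n → Fin n → Fin n
maxV x y = if toℕ y <ᵇ toℕ x then x else y

data Path {n : ℕ} (E : List (Edge n)) : Fin n → Fin n → Set where
  here : ∀ {v} → Path E v v
  step : ∀ {v w u} → ((v , w) ∈ E ⊎ (w , v) ∈ E) → Path E w u → Path E v u

record State (n : ℕ) : Set where
  constructor st
  field
    par   : Fin n → Fin n
    edges : List (Edge n)
open State public

IsRoot : ∀ {n} → State n → Fin n → Set
IsRoot s v = par s v ≡ v

initial : ∀ {n} → List (Edge n) → State n
initial G = st (λ v → v) G

-- A message (t , x): vertex x is sent to vertex t.
Msg : ℕ → Set
Msg n = Fin n × Fin n

connect : ∀ {n} → State n → List (Msg n)
connect s = Data.List.map (λ { (v , w) → (maxV v w , minV v w) }) (edges s)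

parentConnect : ∀ {n} → State n → List (Msg n)
parentConnect s =
  Data.List.map (λ { (v , w) → let x = par s v ; y = par s w in (maxV x y , minV x y) }) (edges s)

extendedConnect : ∀ {n} → State n → List (Msg n)
extendedConnect s = concatMap f (edges s)
  where
  f : _ → List (Msg _)
  f (v , w) = let x = par s v ; y = par s w in
    if toℕ y <ᵇ toℕ x then (v , y) ∷ (x , y) ∷ [] else (w , x) ∷ (y , x) ∷ []

minSent : ∀ {n} → List (Msg n) → Fin n → Fin n → Fin n
minSent ms v a = foldr (λ { (t , x) acc → case? t x acc }) a ms
  where
  case? : _ → _ → _ → _
  case? t x acc with t ≟ v
  ... | yes _ = minV acc x
  ... | no _ = acc

update : ∀ {n} → List (Msg n) → State n → State n
update ms s = st (λ v → minSent ms v (par s v)) (edges s)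

rootUpdate : ∀ {n} → List (Msg n) → State n → State n
rootUpdate ms s = st f (edges s)
  where
  f : _ → _
  f v with par s v ≟ v
  ... | yes _ = minSent ms v (par s v)
  ... | no _ = par s v

shortcut : ∀ {n} → State n → State n
shortcut s = st (λ v → par s (par s v)) (edges s)

alter : ∀ {n} → State n → State n
alter s = st (par s) (concatMap f (edges s))
  where
  f : _ → List (Edge _)
  f (v , w) with par s v ≟ par s w
  ... | yes _ = []
  ... | no _ = (par s v , par s w) ∷ []

data Alg : Set where
  P E A R RA : Alg

-- The states after each operation of one round started in state s
-- (a connect operation changes neither parents nor edges, so the
-- state after it equals s and is already covered by s).
roundStates : ∀ {n} → Alg → State n → List (State n)
roundStates P s = let s1 = update (parentConnect s) s ; s2 = shortcut s1 in s1 ∷ s2 ∷ []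
roundStates E s = let s1 = update (extendedConnect s) s ; s2 = shortcut s1 in s1 ∷ s2 ∷ []
roundStates A s = let s1 = update (connect s) s ; s2 = shortcut s1 ; s3 = alter s2 in s1 ∷ s2 ∷ s3 ∷ []
roundStates R s = let s1 = rootUpdate (parentConnect s) s ; s2 = shortcut s1 in s1 ∷ s2 ∷ []
roundStates RA s = let s1 = rootUpdate (connect s) s ; s2 = shortcut s1 ; s3 = alter s2 in s1 ∷ s2 ∷ s3 ∷ []

roundEnd : ∀ {n} → Alg → State n → State n
roundEnd P s = shortcut (update (parentConnect s) s)
roundEnd E s = shortcut (update (extendedConnect s) s)
roundEnd A s = alter (shortcut (update (connect s) s))
roundEnd R s = shortcut (rootUpdate (parentConnect s) s)
roundEnd RA s = alter (shortcut (rootUpdate (connect s) s))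

RoundChanges : ∀ {n} → Alg → State n → Set
RoundChanges alg s = ∃[ s' ] (s' ∈ roundStates alg s × ∃[ v ] ¬ (par s' v ≡ par s v))

-- States at which a round starts: the initial state, and the end of any
-- round in which some parent changed (otherwise the algorithm stops).
data RoundStart {n : ℕ} (alg : Alg) (G : List (Edge n)) : State n → Set where
  start : RoundStart alg G (initial G)
  next  : ∀ {s} → RoundStart alg G s → RoundChanges alg s →
          RoundStart alg G (roundEnd alg s)

data Reachable {n : ℕ} (alg : Alg) (G : List (Edge n)) : State n → Set where
  atStart : ∀ {s} → RoundStart alg G s → Reachable alg G s
  inRound : ∀ {s s'} → RoundStart alg G s → s' ∈ roundStates alg s → Reachable alg G s'

module Submission where

-- Along any run we maintain the invariant  Inv G s :
--   (a) parents point downward: toℕ (par s v) ≤ toℕ v for every v, and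
--   (b) any two roots of s joined by a path of input edges G are joined by a
--       path of current edges  edges s.
-- The operations fall into two kinds.
--  * update, root-update and shortcut keep the edge set and only LOWER
--    parents.  Lowering parents preserves (a), and by (a) every root after the
--    step was already a root before it (a root could only become smaller), so
--    (b) carries over unchanged.
--  * alter keeps the parents and replaces every edge (v , w) by
--    (par v , par w), deleting it when both ends coincide.  Applying par to a
--    current path between two roots therefore yields a current path between
--    the same roots (roots are fixed by par).

open import Defs
open import Data.Nat using (ℕ; _≤_; _<ᵇ_)
open import Data.Nat.Properties using (≤-refl; ≤-trans; ≤-antisym; <ᵇ⇒<; <⇒≤)
open import Data.Fin using (Fin; toℕ; _≟_)
open import Data.Fin.Properties using (toℕ-injective)
open import Data.List using (List; []; _∷_)
open import Data.List.Membership.Propositional using (_∈_; lose)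
open import Data.List.Membership.Propositional.Properties using (∈-concatMap⁺)
open import Data.List.Relation.Unary.Any using (here; there)
open import Data.Bool using (true; false; T)
open import Data.Product using (_×_; _,_; proj₂)
open import Data.Sum using (_⊎_; inj₁; inj₂)
open import Relation.Nullary using (yes; no)
open import Relation.Binary.PropositionalEquality using (_≡_; refl; sym; subst)
open import Function using (_∋_)

ParentsBelow : ∀ {n} → State n → Set
ParentsBelow s = ∀ v → toℕ (par s v) ≤ toℕ v

RootsConnected : ∀ {n} → List (Edge n) → State n → Set
RootsConnected G s =
  ∀ r₁ r₂ → IsRoot s r₁ → IsRoot s r₂ → Path G r₁ r₂ → Path (edges s) r₁ r₂

Inv : ∀ {n} → List (Edge n) → State n → Set
Inv G s = ParentsBelow s × RootsConnected G s

minV-≤ : ∀ {n} (x y : Fin n) → toℕ (minV x y) ≤ toℕ x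
minV-≤ x y with toℕ y <ᵇ toℕ x in lt
... | true  = <⇒≤ (<ᵇ⇒< (toℕ y) (toℕ x) (subst T (sym lt) _))
... | false = ≤-refl

minSent-≤ : ∀ {n} (ms : List (Msg n)) (v a : Fin n) → toℕ (minSent ms v a) ≤ toℕ a
minSent-≤ []             v a = ≤-refl
minSent-≤ ((t , x) ∷ ms) v a with t ≟ v
... | yes _ = ≤-trans (minV-≤ (minSent ms v a) x) (minSent-≤ ms v a)
... | no  _ = minSent-≤ ms v a

-- Lowering parents while keeping the edges preserves the invariant: a root of
-- the new state was a root before, since its parent can only have decreased.
lowerParents : ∀ {n} {G : List (Edge n)} (s : State n) (q : Fin n → Fin n) →
               (∀ v → toℕ (q v) ≤ toℕ (par s v)) →
               Inv G s → Inv G (st q (edges s))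
lowerParents s q q≤par (below , connected) =
  (λ v → ≤-trans (q≤par v) (below v)) ,
  (λ r₁ r₂ root₁ root₂ → connected r₁ r₂ (stillRoot r₁ root₁) (stillRoot r₂ root₂))
  where
  stillRoot : ∀ r → q r ≡ r → par s r ≡ r
  stillRoot r qr≡r =
    toℕ-injective (≤-antisym (below r)
                             (subst (λ z → toℕ z ≤ toℕ (par s r)) qr≡r (q≤par r)))

update-inv : ∀ {n} {G : List (Edge n)} (ms : List (Msg n)) (s : State n) →
             Inv G s → Inv G (update ms s)
update-inv ms s = lowerParents s _ (λ v → minSent-≤ ms v (par s v))

rootUpdate-inv : ∀ {n} {G : List (Edge n)} (ms : List (Msg n)) (s : State n) →
                 Inv G s → Inv G (rootUpdate ms s)
rootUpdate-inv ms s = lowerParents s _ rootUpdate-≤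
  where
  rootUpdate-≤ : ∀ v → toℕ (par (rootUpdate ms s) v) ≤ toℕ (par s v)
  rootUpdate-≤ v with par s v ≟ v
  ... | yes _ = minSent-≤ ms v (par s v)
  ... | no  _ = ≤-refl

-- Shortcutting replaces par v by par (par v), which is lower by (a).
shortcut-inv : ∀ {n} {G : List (Edge n)} (s : State n) → Inv G s → Inv G (shortcut s)
shortcut-inv s inv@(below , _) = lowerParents s _ (λ v → below (par s v)) inv

contractPath : ∀ {n} {Es Es' : List (Edge n)} (p : Fin n → Fin n) →
               (∀ {v w} → (v , w) ∈ Es → p v ≡ p w ⊎ (p v , p w) ∈ Es') →
               ∀ {a b} → Path Es a b → Path Es' (p a) (p b)
contractPath p edgeImage here = here
contractPath p edgeImage (step (inj₁ vw) rest) with edgeImage vw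
... | inj₁ pv≡pw rewrite pv≡pw = contractPath p edgeImage rest
... | inj₂ e'    = step (inj₁ e') (contractPath p edgeImage rest)
contractPath p edgeImage (step (inj₂ wv) rest) with edgeImage wv
... | inj₁ pw≡pv rewrite sym pw≡pv = contractPath p edgeImage rest
... | inj₂ e'    = step (inj₂ e') (contractPath p edgeImage rest)

-- The list that alter produces for (v , w) is
-- reached by unification against  edges (alter s) ; splitting on the
-- comparison of the parents first makes that list compute.
alter-edge : ∀ {n} (s : State n) {v w : Fin n} → (v , w) ∈ edges s →
             par s v ≡ par s w ⊎ (par s v , par s w) ∈ edges (alter s)
alter-edge s {v} {w} vw∈
  with par s v ≟ par s w
     | ((par s v , par s w) ∈ _ → (par s v , par s w) ∈ edges (alter s))
       ∋ (λ kept → ∈-concatMap⁺ _ (lose vw∈ kept))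
... | yes pv≡pw | _      = inj₁ pv≡pw
... | no  _     | inject = inj₂ (inject (here refl))

-- alter preserves the invariant: roots are fixed by par, so contracting a
-- current path between two roots gives a new current path between them.
alter-inv : ∀ {n} {G : List (Edge n)} (s : State n) → Inv G s → Inv G (alter s)
alter-inv s (below , connected) = below , connected'
  where
  connected' : RootsConnected _ (alter s)
  connected' r₁ r₂ root₁ root₂ g
    with contractPath (par s) (alter-edge s) (connected r₁ r₂ root₁ root₂ g)
  ... | path rewrite root₁ | root₂ = path

shortcutRound-inv : ∀ {n} {G : List (Edge n)} {s₁ s' : State n} →
                    Inv G s₁ → s' ∈ s₁ ∷ shortcut s₁ ∷ [] → Inv G s'
shortcutRound-inv inv (here refl)         = inv
shortcutRound-inv inv (there (here refl)) = shortcut-inv _ inv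

alterRound-inv : ∀ {n} {G : List (Edge n)} {s₁ s' : State n} →
                 Inv G s₁ → s' ∈ s₁ ∷ shortcut s₁ ∷ alter (shortcut s₁) ∷ [] → Inv G s'
alterRound-inv inv (here refl)                 = inv
alterRound-inv inv (there (here refl))         = shortcut-inv _ inv
alterRound-inv inv (there (there (here refl))) = alter-inv _ (shortcut-inv _ inv)

round-inv : ∀ {n} {G : List (Edge n)} (alg : Alg) (s s' : State n) →
            Inv G s → s' ∈ roundStates alg s → Inv G s'
round-inv P  s _ inv = shortcutRound-inv (update-inv (parentConnect s) s inv)
round-inv E  s _ inv = shortcutRound-inv (update-inv (extendedConnect s) s inv)
round-inv A  s _ inv = alterRound-inv (update-inv (connect s) s inv)
round-inv R  s _ inv = shortcutRound-inv (rootUpdate-inv (parentConnect s) s inv)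
round-inv RA s _ inv = alterRound-inv (rootUpdate-inv (connect s) s inv)

roundEnd∈roundStates : ∀ {n} (alg : Alg) (s : State n) → roundEnd alg s ∈ roundStates alg s
roundEnd∈roundStates P  s = there (here refl)
roundEnd∈roundStates E  s = there (here refl)
roundEnd∈roundStates A  s = there (there (here refl))
roundEnd∈roundStates R  s = there (here refl)
roundEnd∈roundStates RA s = there (there (here refl))

roundStart-inv : ∀ {n} {G : List (Edge n)} (alg : Alg) {s : State n} →
                 RoundStart alg G s → Inv G s
roundStart-inv alg start          = (λ v → ≤-refl) , (λ r₁ r₂ _ _ g → g)
roundStart-inv alg (next {s} rs _) =
  round-inv alg s _ (roundStart-inv alg rs) (roundEnd∈roundStates alg s)

reachable-inv : ∀ {n} {G : List (Edge n)} (alg : Alg) {s : State n} →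
                Reachable alg G s → Inv G s
reachable-inv alg (atStart rs)         = roundStart-inv alg rs
reachable-inv alg (inRound {s} rs s'∈) = round-inv alg s _ (roundStart-inv alg rs) s'∈

lemma3 : (alg : Alg) (n : ℕ) (G : List (Edge n)) (s : State n) →
         Reachable alg G s →
         (r₁ r₂ : Fin n) → IsRoot s r₁ → IsRoot s r₂ →
         Path G r₁ r₂ → Path (edges s) r₁ r₂
lemma3 alg n G s reachable = proj₂ (reachable-inv alg reachable)
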